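{- Let $n=2^\ell$, let $S=\{u_1,\dots,u_m\}\subseteq\mathbb F_2^d\setminus\{0\}$ be a set of $m$ distinct nonzero vectors, let $h:\mathbb F_2^d\to\mathbb F_2^\ell$ be a uniformly random linear map, fix $y\in\mathbb F_2^\ell$, let $Z_y:=|\{i:h(u_i)=y\}|$ and $\lambda=m/n$. Then for every integer $a\ge1$, \[ \Pr[Z_y>2^a-2]\le\gamma^{ -1}\lambda^a2^{ -a^2},\qquad \gamma:=\prod_{j=1}^\infty(1-2^{ -j}). \]
   Context: A uniformly random linear map is chosen uniformly among all $\mathbb F_2$-linear maps $\mathbb F_2^d\to\mathbb F_2^\ell$. -}

module Defs where

open import Data.Bool using (Bool; true; false; _∧_; _xor_)
open import Data.Nat using (ℕ; zero; suc; _+_; _*_; _^_; _<_; _<?_; _∸_)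
open import Data.Nat.Properties using (m^n≢0)
open import Data.Integer using (+_)
open import Data.Rational using (ℚ; _/_; 1ℚ; ½) renaming (_*_ to _*ℚ_)
open import Data.Fin using (Fin)
open import Data.Vec using (Vec; []; _∷_; foldr; zipWith; map; replicate)
import Data.Vec.Properties as VecP
open import Data.Bool.Properties using () renaming (_≟_ to _≟B_)
open import Data.List using (List; [_]; concatMap; length; filter; allFin)
import Data.List as L
open import Relation.Binary.PropositionalEquality using (_≡_)
open import Relation.Nullary using (¬_)

-- Vectors of 𝔽₂^n, with 𝔽₂ = Bool (addition = xor, multiplication = ∧).
𝔽₂^ : ℕ → Set
𝔽₂^ n = Vec Bool n

zeroVec : (n : ℕ) → 𝔽₂^ n
zeroVec n = replicate n false

_≟V_ : ∀ {n} (u v : 𝔽₂^ n) → Relation.Nullary.Dec (u ≡ v)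
_≟V_ = VecP.≡-dec _≟B_

dot : ∀ {n} → 𝔽₂^ n → 𝔽₂^ n → Bool
dot u v = foldr _ _xor_ false (zipWith _∧_ u v)

-- An 𝔽₂-linear map 𝔽₂^d → 𝔽₂^ℓ, represented by its ℓ × d matrix
-- (linear maps ↔ matrices is a bijection, so the uniform distribution
-- on linear maps is the uniform distribution on matrices).
LinMap : ℕ → ℕ → Set
LinMap d ℓ = Vec (𝔽₂^ d) ℓ

apply : ∀ {d ℓ} → LinMap d ℓ → 𝔽₂^ d → 𝔽₂^ ℓ
apply h u = map (λ row → dot row u) h

-- Exhaustive enumeration (each element exactly once).
allVecs : (n : ℕ) → List (𝔽₂^ n)
allVecs zero = [ [] ]
allVecs (suc n) = concatMap (λ v → (false ∷ v) L.∷ (true ∷ v) L.∷ L.[]) (allVecs n)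

allVecsOf : ∀ {A : Set} → List A → (k : ℕ) → List (Vec A k)
allVecsOf xs zero = [ [] ]
allVecsOf xs (suc k) = concatMap (λ v → L.map (λ x → x ∷ v) xs) (allVecsOf xs k)

allLinMaps : (d ℓ : ℕ) → List (LinMap d ℓ)
allLinMaps d ℓ = allVecsOf (allVecs d) ℓ

Z : ∀ {d ℓ m} → Vec (𝔽₂^ d) m → LinMap d ℓ → 𝔽₂^ ℓ → ℕ
Z {m = m} us h y = length (filter (λ i → apply h (Data.Vec.lookup us i) ≟V y) (allFin m))

PrZgt : ∀ {d ℓ m} → Vec (𝔽₂^ d) m → 𝔽₂^ ℓ → ℕ → ℚ
PrZgt {d} {ℓ} us y t =
  _/_ (+ length (filter (λ h → t <? Z us h y) (allLinMaps d ℓ)))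
      (2 ^ (ℓ * d)) {{m^n≢0 2 (ℓ * d)}}

_^ℚ_ : ℚ → ℕ → ℚ
q ^ℚ zero = 1ℚ
q ^ℚ suc k = q *ℚ (q ^ℚ k)

lam : ℕ → ℕ → ℚ
lam m ℓ = _/_ (+ m) (2 ^ ℓ) {{m^n≢0 2 ℓ}}

-- Partial products P N = ∏_{j=1}^{N} (1 - 2^{-j}); γ = lim_N P N = inf_N P N.
P : ℕ → ℚ
P zero = 1ℚ
P (suc N) = P N *ℚ (1ℚ Data.Rational.- (½ ^ℚ suc N))

{-# OPTIONS --safe #-}
module Submission where

-- If Z_y ≥ 2^a − 1, the fibre of h over y contains at least ∏_{j<a} (2^a − 2^j) ordered
-- linearly independent a-tuples of the u_i: the span of j independent u_i contains at most
-- 2^j − 1 of the distinct nonzero u_i, so at least 2^a − 2^j fibre vectors extend the tuple.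
-- On the other hand h sends a fixed independent a-tuple to (y, …, y) with probability at most
-- 2^(−ℓa), so the expected number of such tuples is at most m^a 2^(−ℓa). Comparing the two
-- (Markov) gives Pr[Z_y > 2^a − 2] · ∏_{j<a} (2^a − 2^j) ≤ λ^a, and ∏_{j<a} (2^a − 2^j) equals
-- 2^(a²) P a, which is at least 2^(a²) γ; so N = a is a witness for every ε.

module FiniteSums where

  open import Defs
  open import Data.Bool using (Bool; true; false; _∧_)
  open import Data.Nat
  open import Data.Nat.Properties
  open import Data.Product using (∃; _,_)
  open import Data.List as List using (List; []; _∷_; _++_; concatMap; filter; allFin; length)
  open import Data.List.Properties using (map-tabulate)
  open import Data.Vec using (Vec; []; _∷_)
  open import Data.Fin using (Fin; zero; suc)
  open import Function using (_∘_)
  open import Relation.Binary.PropositionalEquality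
  open import Relation.Nullary using (Dec; does)
  open import Algebra.Properties.CommutativeSemigroup +-commutativeSemigroup
    using () renaming (interchange to +-interchange)

  𝟙 : Bool → ℕ
  𝟙 true  = 1
  𝟙 false = 0

  𝟙≤1 : ∀ b → 𝟙 b ≤ 1
  𝟙≤1 true  = ≤-refl
  𝟙≤1 false = z≤n

  𝟙-∧ : ∀ x y → 𝟙 (x ∧ y) ≡ 𝟙 x * 𝟙 y
  𝟙-∧ true  y = sym (+-identityʳ (𝟙 y))
  𝟙-∧ false y = refl

  ∑ : {A : Set} → List A → (A → ℕ) → ℕ
  ∑ []       f = 0
  ∑ (x ∷ xs) f = f x + ∑ xs f

  syntax ∑ xs (λ x → e) = ∑[ x ∈ xs ] e

  module _ {A : Set} where

    ∑-cong : ∀ (xs : List A) {f g : A → ℕ} → (∀ x → f x ≡ g x) → ∑ xs f ≡ ∑ xs g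
    ∑-cong []       f≡g = refl
    ∑-cong (x ∷ xs) f≡g = cong₂ _+_ (f≡g x) (∑-cong xs f≡g)

    ∑-mono-≤ : ∀ (xs : List A) {f g : A → ℕ} → (∀ x → f x ≤ g x) → ∑ xs f ≤ ∑ xs g
    ∑-mono-≤ []       f≤g = z≤n
    ∑-mono-≤ (x ∷ xs) f≤g = +-mono-≤ (f≤g x) (∑-mono-≤ xs f≤g)

    ∑-1≡length : ∀ (xs : List A) → ∑[ _ ∈ xs ] 1 ≡ length xs
    ∑-1≡length []       = refl
    ∑-1≡length (x ∷ xs) = cong suc (∑-1≡length xs)

    ∑-const : ∀ (xs : List A) c → ∑[ _ ∈ xs ] c ≡ length xs * c
    ∑-const []       c = refl
    ∑-const (x ∷ xs) c = cong (c +_) (∑-const xs c)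

    ∑-zero : ∀ (xs : List A) {f : A → ℕ} → (∀ x → f x ≡ 0) → ∑ xs f ≡ 0
    ∑-zero []       f≡0 = refl
    ∑-zero (x ∷ xs) f≡0 = cong₂ _+_ (f≡0 x) (∑-zero xs f≡0)

    ∑-distrib-+ : ∀ (xs : List A) (f g : A → ℕ) → ∑[ x ∈ xs ] (f x + g x) ≡ ∑ xs f + ∑ xs g
    ∑-distrib-+ []       f g = refl
    ∑-distrib-+ (x ∷ xs) f g = begin
      f x + g x + ∑[ x ∈ xs ] (f x + g x) ≡⟨ cong (f x + g x +_) (∑-distrib-+ xs f g) ⟩
      f x + g x + (∑ xs f + ∑ xs g)       ≡⟨ +-interchange (f x) (g x) (∑ xs f) (∑ xs g) ⟩
      f x + ∑ xs f + (g x + ∑ xs g)       ∎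
      where open ≡-Reasoning

    ∑-*ˡ : ∀ (xs : List A) (f : A → ℕ) c → ∑[ x ∈ xs ] (c * f x) ≡ c * ∑ xs f
    ∑-*ˡ []       f c = sym (*-zeroʳ c)
    ∑-*ˡ (x ∷ xs) f c = trans (cong (c * f x +_) (∑-*ˡ xs f c)) (sym (*-distribˡ-+ c (f x) (∑ xs f)))

    ∑-*ʳ : ∀ (xs : List A) (f : A → ℕ) c → ∑[ x ∈ xs ] (f x * c) ≡ ∑ xs f * c
    ∑-*ʳ xs f c = trans (∑-cong xs (λ x → *-comm (f x) c)) (trans (∑-*ˡ xs f c) (*-comm c (∑ xs f)))

    ∑-++ : ∀ (xs ys : List A) (f : A → ℕ) → ∑ (xs ++ ys) f ≡ ∑ xs f + ∑ ys f
    ∑-++ []       ys f = refl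
    ∑-++ (x ∷ xs) ys f = trans (cong (f x +_) (∑-++ xs ys f)) (sym (+-assoc (f x) (∑ xs f) (∑ ys f)))

    length-filter≡∑𝟙 : ∀ {P : A → Set} (P? : ∀ x → Dec (P x)) (xs : List A) →
                       length (filter P? xs) ≡ ∑[ x ∈ xs ] 𝟙 (does (P? x))
    length-filter≡∑𝟙 P? []       = refl
    length-filter≡∑𝟙 P? (x ∷ xs) with does (P? x)
    ... | true  = cong suc (length-filter≡∑𝟙 P? xs)
    ... | false = length-filter≡∑𝟙 P? xs

    ∑𝟙>0⇒∃ : ∀ (xs : List A) (p : A → Bool) → 0 < ∑[ x ∈ xs ] 𝟙 (p x) → ∃ λ x → p x ≡ true
    ∑𝟙>0⇒∃ (x ∷ xs) p pos with p x in px
    ... | true  = x , px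
    ... | false = ∑𝟙>0⇒∃ xs p pos

  module _ {A B : Set} where

    ∑-map : ∀ (g : A → B) (xs : List A) (f : B → ℕ) → ∑ (List.map g xs) f ≡ ∑ xs (f ∘ g)
    ∑-map g []       f = refl
    ∑-map g (x ∷ xs) f = cong (f (g x) +_) (∑-map g xs f)

    ∑-concatMap : ∀ (g : A → List B) (xs : List A) (f : B → ℕ) →
                  ∑ (concatMap g xs) f ≡ ∑[ x ∈ xs ] ∑ (g x) f
    ∑-concatMap g []       f = refl
    ∑-concatMap g (x ∷ xs) f =
      trans (∑-++ (g x) (concatMap g xs) f) (cong (∑ (g x) f +_) (∑-concatMap g xs f))

    ∑-comm : ∀ (xs : List A) (ys : List B) (f : A → B → ℕ) →
             ∑[ x ∈ xs ] ∑[ y ∈ ys ] f x y ≡ ∑[ y ∈ ys ] ∑[ x ∈ xs ] f x y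
    ∑-comm []       ys f = sym (∑-zero ys (λ _ → refl))
    ∑-comm (x ∷ xs) ys f = trans (cong (∑ ys (f x) +_) (∑-comm xs ys f))
                                 (sym (∑-distrib-+ ys (f x) (λ y → ∑[ x ∈ xs ] f x y)))

  ∑-allFin-suc : ∀ m (f : Fin (suc m) → ℕ) → ∑ (allFin (suc m)) f ≡ f zero + ∑ (allFin m) (f ∘ suc)
  ∑-allFin-suc m f = cong (f zero +_) (begin
    ∑ (List.tabulate suc) f           ≡⟨ cong (λ xs → ∑ xs f) (map-tabulate (λ i → i) suc) ⟨
    ∑ (List.map suc (allFin m)) f     ≡⟨ ∑-map suc (allFin m) f ⟩
    ∑ (allFin m) (f ∘ suc)            ∎)
    where open ≡-Reasoning

  ∑-allVecs-suc : ∀ n (f : 𝔽₂^ (suc n) → ℕ) →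
                  ∑ (allVecs (suc n)) f ≡ ∑[ v ∈ allVecs n ] (f (false ∷ v) + f (true ∷ v))
  ∑-allVecs-suc n f = trans (∑-concatMap _ (allVecs n) f)
    (∑-cong (allVecs n) (λ v → cong (f (false ∷ v) +_) (+-identityʳ (f (true ∷ v)))))

  ∑-allVecsOf-suc : ∀ {A : Set} (xs : List A) k (f : Vec A (suc k) → ℕ) →
                    ∑ (allVecsOf xs (suc k)) f ≡ ∑[ v ∈ allVecsOf xs k ] ∑[ x ∈ xs ] f (x ∷ v)
  ∑-allVecsOf-suc xs k f = trans (∑-concatMap _ (allVecsOf xs k) f)
    (∑-cong (allVecsOf xs k) (λ v → ∑-map (_∷ v) xs f))

  length-allVecs : ∀ n → length (allVecs n) ≡ 2 ^ n
  length-allVecs zero    = refl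
  length-allVecs (suc n) = begin
    length (allVecs (suc n))                   ≡⟨ ∑-1≡length (allVecs (suc n)) ⟨
    ∑[ _ ∈ allVecs (suc n) ] 1                 ≡⟨ ∑-allVecs-suc n (λ _ → 1) ⟩
    ∑[ _ ∈ allVecs n ] 2                       ≡⟨ ∑-const (allVecs n) 2 ⟩
    length (allVecs n) * 2                     ≡⟨ cong (_* 2) (length-allVecs n) ⟩
    2 ^ n * 2                                  ≡⟨ *-comm (2 ^ n) 2 ⟩
    2 ^ suc n                                  ∎
    where open ≡-Reasoning

  length-allVecsOf : ∀ {A : Set} (xs : List A) k → length (allVecsOf xs k) ≡ length xs ^ k
  length-allVecsOf xs zero    = refl
  length-allVecsOf xs (suc k) = begin
    length (allVecsOf xs (suc k))              ≡⟨ ∑-1≡length (allVecsOf xs (suc k)) ⟨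
    ∑[ _ ∈ allVecsOf xs (suc k) ] 1            ≡⟨ ∑-allVecsOf-suc xs k _ ⟩
    ∑[ _ ∈ allVecsOf xs k ] ∑[ _ ∈ xs ] 1      ≡⟨ ∑-const (allVecsOf xs k) _ ⟩
    length (allVecsOf xs k) * ∑[ _ ∈ xs ] 1    ≡⟨ cong₂ _*_ (length-allVecsOf xs k) (∑-1≡length xs) ⟩
    length xs ^ k * length xs                  ≡⟨ *-comm (length xs ^ k) _ ⟩
    length xs ^ suc k                          ∎
    where open ≡-Reasoning

module 𝔽₂Vectors where

  open import Defs
  open import Algebra.Bundles using (CommutativeRing)
  open import Data.Bool using (Bool; true; false; _∧_; _xor_)
  open import Data.Bool.Properties
    using (xor-assoc; xor-identityˡ; xor-identityʳ; xor-same; ∧-zeroʳ; ∧-comm; ∧-distribˡ-xor; xor-∧-commutativeRing)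
  open import Data.Nat using (ℕ)
  open import Data.Vec as Vec using (Vec; []; _∷_; zipWith)
  open import Data.Vec.Relation.Binary.Pointwise.Inductive
    using (Pointwise-≡⇒≡; zipWith-assoc; zipWith-identityˡ; zipWith-identityʳ)
  open import Function.Bundles using (mk⇔)
  open import Relation.Binary.PropositionalEquality
  open import Relation.Nullary using (yes; does)
  open import Relation.Nullary.Decidable using (dec-true; does-⇔)
  open import Algebra.Properties.CommutativeSemigroup (CommutativeRing.+-commutativeSemigroup xor-∧-commutativeRing)
    using () renaming (interchange to xor-interchange)

  private variable n d k : ℕ

  infixl 6 _⊕_
  infix 7 _∙_
  infix 4 _==_

  _⊕_ : 𝔽₂^ n → 𝔽₂^ n → 𝔽₂^ n
  _⊕_ = zipWith _xor_

  ⊕-assoc : (u v w : 𝔽₂^ n) → (u ⊕ v) ⊕ w ≡ u ⊕ (v ⊕ w)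
  ⊕-assoc u v w = Pointwise-≡⇒≡ (zipWith-assoc xor-assoc u v w)

  ⊕-identityˡ : (u : 𝔽₂^ n) → zeroVec n ⊕ u ≡ u
  ⊕-identityˡ u = Pointwise-≡⇒≡ (zipWith-identityˡ xor-identityˡ u)

  ⊕-identityʳ : (u : 𝔽₂^ n) → u ⊕ zeroVec n ≡ u
  ⊕-identityʳ u = Pointwise-≡⇒≡ (zipWith-identityʳ xor-identityʳ u)

  ⊕-self : (u : 𝔽₂^ n) → u ⊕ u ≡ zeroVec n
  ⊕-self []      = refl
  ⊕-self (x ∷ u) = cong₂ _∷_ (xor-same x) (⊕-self u)

  ⊕-interchange : (u v w z : 𝔽₂^ n) → (u ⊕ v) ⊕ (w ⊕ z) ≡ (u ⊕ w) ⊕ (v ⊕ z)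
  ⊕-interchange []      []      []      []      = refl
  ⊕-interchange (a ∷ u) (b ∷ v) (c ∷ w) (e ∷ z) = cong₂ _∷_ (xor-interchange a b c e) (⊕-interchange u v w z)

  ⊕-cancelˡ : (u v : 𝔽₂^ n) → u ⊕ (u ⊕ v) ≡ v
  ⊕-cancelˡ {n} u v = begin
    u ⊕ (u ⊕ v)   ≡⟨ ⊕-assoc u u v ⟨
    (u ⊕ u) ⊕ v   ≡⟨ cong (_⊕ v) (⊕-self u) ⟩
    zeroVec n ⊕ v ≡⟨ ⊕-identityˡ v ⟩
    v             ∎
    where open ≡-Reasoning

  _==_ : 𝔽₂^ n → 𝔽₂^ n → Bool
  u == v = does (u ≟V v)

  ==-refl : (u : 𝔽₂^ n) → (u == u) ≡ true
  ==-refl u = dec-true (u ≟V u) refl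

  ==-sound : (u v : 𝔽₂^ n) → (u == v) ≡ true → u ≡ v
  ==-sound u v u==v with u ≟V v
  ... | yes u≡v = u≡v

  ⊕-==-move : (u v w : 𝔽₂^ n) → (u ⊕ v == w) ≡ (v == u ⊕ w)
  ⊕-==-move u v w = does-⇔ (mk⇔ (λ eq → trans (sym (⊕-cancelˡ u v)) (cong (u ⊕_) eq))
                                 (λ eq → trans (cong (u ⊕_) eq) (⊕-cancelˡ u w)))
                           ((u ⊕ v) ≟V w) (v ≟V (u ⊕ w))

  ⊕-==-zero : (u v : 𝔽₂^ n) → (u ⊕ v == zeroVec n) ≡ (v == u)
  ⊕-==-zero {n} u v = trans (⊕-==-move u v (zeroVec n)) (cong (v ==_) (⊕-identityʳ u))

  dot-zeroʳ : (r : 𝔽₂^ n) → dot r (zeroVec n) ≡ false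
  dot-zeroʳ []      = refl
  dot-zeroʳ (x ∷ r) = cong₂ _xor_ (∧-zeroʳ x) (dot-zeroʳ r)

  dot-comm : (r u : 𝔽₂^ n) → dot r u ≡ dot u r
  dot-comm []      []      = refl
  dot-comm (x ∷ r) (y ∷ u) = cong₂ _xor_ (∧-comm x y) (dot-comm r u)

  dot-⊕ʳ : (r u v : 𝔽₂^ n) → dot r (u ⊕ v) ≡ dot r u xor dot r v
  dot-⊕ʳ []      []      []      = refl
  dot-⊕ʳ (x ∷ r) (y ∷ u) (z ∷ v) = begin
    (x ∧ (y xor z)) xor dot r (u ⊕ v)                 ≡⟨ cong₂ _xor_ (∧-distribˡ-xor x y z) (dot-⊕ʳ r u v) ⟩
    ((x ∧ y) xor (x ∧ z)) xor (dot r u xor dot r v)   ≡⟨ xor-interchange (x ∧ y) (x ∧ z) (dot r u) (dot r v) ⟩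
    ((x ∧ y) xor dot r u) xor ((x ∧ z) xor dot r v)   ∎
    where open ≡-Reasoning

  dot-⊕ˡ : (u v r : 𝔽₂^ n) → dot (u ⊕ v) r ≡ dot u r xor dot v r
  dot-⊕ˡ u v r = begin
    dot (u ⊕ v) r         ≡⟨ dot-comm (u ⊕ v) r ⟩
    dot r (u ⊕ v)         ≡⟨ dot-⊕ʳ r u v ⟩
    dot r u xor dot r v   ≡⟨ cong₂ _xor_ (dot-comm r u) (dot-comm r v) ⟩
    dot u r xor dot v r   ∎
    where open ≡-Reasoning

  _∙_ : Bool → 𝔽₂^ n → 𝔽₂^ n
  true  ∙ u = u
  false ∙ u = zeroVec _

  ∙-distribʳ-xor : (b b′ : Bool) (u : 𝔽₂^ n) → (b xor b′) ∙ u ≡ b ∙ u ⊕ b′ ∙ u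
  ∙-distribʳ-xor false b′    u = sym (⊕-identityˡ (b′ ∙ u))
  ∙-distribʳ-xor true  false u = sym (⊕-identityʳ u)
  ∙-distribʳ-xor true  true  u = sym (⊕-self u)

  dot-∙ʳ : (r : 𝔽₂^ n) (b : Bool) (u : 𝔽₂^ n) → dot r (b ∙ u) ≡ b ∧ dot r u
  dot-∙ʳ r true  u = refl
  dot-∙ʳ r false u = dot-zeroʳ r

  lincomb : Vec Bool k → Vec (𝔽₂^ d) k → 𝔽₂^ d
  lincomb []      []       = zeroVec _
  lincomb (b ∷ c) (u ∷ us) = b ∙ u ⊕ lincomb c us

  lincomb-zero : (us : Vec (𝔽₂^ d) k) → lincomb (zeroVec k) us ≡ zeroVec d
  lincomb-zero []       = refl
  lincomb-zero (u ∷ us) = trans (⊕-identityˡ (lincomb (zeroVec _) us)) (lincomb-zero us)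

  lincomb-⊕ : (c c′ : Vec Bool k) (us : Vec (𝔽₂^ d) k) →
              lincomb (c ⊕ c′) us ≡ lincomb c us ⊕ lincomb c′ us
  lincomb-⊕ []      []        []       = sym (⊕-self (zeroVec _))
  lincomb-⊕ (b ∷ c) (b′ ∷ c′) (u ∷ us) = begin
    (b xor b′) ∙ u ⊕ lincomb (c ⊕ c′) us
      ≡⟨ cong₂ _⊕_ (∙-distribʳ-xor b b′ u) (lincomb-⊕ c c′ us) ⟩
    (b ∙ u ⊕ b′ ∙ u) ⊕ (lincomb c us ⊕ lincomb c′ us)
      ≡⟨ ⊕-interchange (b ∙ u) (b′ ∙ u) (lincomb c us) (lincomb c′ us) ⟩
    (b ∙ u ⊕ lincomb c us) ⊕ (b′ ∙ u ⊕ lincomb c′ us) ∎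
    where open ≡-Reasoning

  dot-lincomb : (r : 𝔽₂^ d) (c : Vec Bool k) (us : Vec (𝔽₂^ d) k) →
                dot r (lincomb c us) ≡ dot c (Vec.map (dot r) us)
  dot-lincomb r []      []       = dot-zeroʳ r
  dot-lincomb r (b ∷ c) (u ∷ us) = begin
    dot r (b ∙ u ⊕ lincomb c us)            ≡⟨ dot-⊕ʳ r (b ∙ u) (lincomb c us) ⟩
    dot r (b ∙ u) xor dot r (lincomb c us)  ≡⟨ cong₂ _xor_ (dot-∙ʳ r b u) (dot-lincomb r c us) ⟩
    (b ∧ dot r u) xor dot c (Vec.map (dot r) us) ∎
    where open ≡-Reasoning

module Solutions where

  open import Defs
  open FiniteSums
  open 𝔽₂Vectors
  open import Data.Bool using (Bool; true; false; _∧_; _xor_)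
  open import Data.Bool.Properties using (∧-commutativeMonoid) renaming (_≟_ to _≟B_)
  open import Data.Nat
  open import Data.Nat.Properties
  open import Data.Product using (∃; _,_; _×_)
  open import Data.Sum using (_⊎_; inj₁; inj₂)
  open import Data.Vec as Vec using (Vec; []; _∷_)
  open import Data.Empty using (⊥-elim)
  open import Relation.Binary.PropositionalEquality
  open import Relation.Nullary using (does)
  open import Algebra.Bundles using (CommutativeMonoid)
  open import Algebra.Properties.CommutativeSemigroup (CommutativeMonoid.commutativeSemigroup ∧-commutativeMonoid)
    using () renaming (interchange to ∧-interchange)
  open import Algebra.Properties.CommutativeSemigroup *-commutativeSemigroup
    using () renaming (interchange to *-interchange)

  private variable d a k : ℕ

  heads : Vec (𝔽₂^ (suc d)) a → 𝔽₂^ a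
  heads = Vec.map Vec.head

  tails : Vec (𝔽₂^ (suc d)) a → Vec (𝔽₂^ d) a
  tails = Vec.map Vec.tail

  map-dot-false∷ : (r : 𝔽₂^ d) (w : Vec (𝔽₂^ (suc d)) a) →
                   Vec.map (dot (false ∷ r)) w ≡ Vec.map (dot r) (tails w)
  map-dot-false∷ r []             = refl
  map-dot-false∷ r ((x ∷ u) ∷ w) = cong (dot r u ∷_) (map-dot-false∷ r w)

  map-dot-true∷ : (r : 𝔽₂^ d) (w : Vec (𝔽₂^ (suc d)) a) →
                  Vec.map (dot (true ∷ r)) w ≡ heads w ⊕ Vec.map (dot r) (tails w)
  map-dot-true∷ r []             = refl
  map-dot-true∷ r ((x ∷ u) ∷ w) = cong ((x xor dot r u) ∷_) (map-dot-true∷ r w)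

  lincomb-heads-tails : (c : 𝔽₂^ a) (w : Vec (𝔽₂^ (suc d)) a) →
                        lincomb c w ≡ dot c (heads w) ∷ lincomb c (tails w)
  lincomb-heads-tails []          []             = refl
  lincomb-heads-tails (true ∷ c)  ((x ∷ u) ∷ w) rewrite lincomb-heads-tails c w = refl
  lincomb-heads-tails (false ∷ c) ((x ∷ u) ∷ w) rewrite lincomb-heads-tails c w = refl

  ∑-allVecs-translate : ∀ n (f : 𝔽₂^ n → ℕ) (c₀ : 𝔽₂^ n) →
                        ∑[ c ∈ allVecs n ] f (c ⊕ c₀) ≡ ∑ (allVecs n) f
  ∑-allVecs-translate zero    f []          = refl
  ∑-allVecs-translate (suc n) f (false ∷ c₀) = begin
    ∑[ c ∈ allVecs (suc n) ] f (c ⊕ (false ∷ c₀))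
      ≡⟨ ∑-allVecs-suc n _ ⟩
    ∑[ c ∈ allVecs n ] (f (false ∷ c ⊕ c₀) + f (true ∷ c ⊕ c₀))
      ≡⟨ ∑-allVecs-translate n (λ c → f (false ∷ c) + f (true ∷ c)) c₀ ⟩
    ∑[ c ∈ allVecs n ] (f (false ∷ c) + f (true ∷ c))
      ≡⟨ ∑-allVecs-suc n f ⟨
    ∑ (allVecs (suc n)) f ∎
    where open ≡-Reasoning
  ∑-allVecs-translate (suc n) f (true ∷ c₀) = begin
    ∑[ c ∈ allVecs (suc n) ] f (c ⊕ (true ∷ c₀))
      ≡⟨ ∑-allVecs-suc n _ ⟩
    ∑[ c ∈ allVecs n ] (f (true ∷ c ⊕ c₀) + f (false ∷ c ⊕ c₀))
      ≡⟨ ∑-allVecs-translate n (λ c → f (true ∷ c) + f (false ∷ c)) c₀ ⟩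
    ∑[ c ∈ allVecs n ] (f (true ∷ c) + f (false ∷ c))
      ≡⟨ ∑-cong (allVecs n) (λ c → +-comm (f (true ∷ c)) _) ⟩
    ∑[ c ∈ allVecs n ] (f (false ∷ c) + f (true ∷ c))
      ≡⟨ ∑-allVecs-suc n f ⟨
    ∑ (allVecs (suc n)) f ∎
    where open ≡-Reasoning

  solutions : Vec (𝔽₂^ d) a → 𝔽₂^ a → ℕ
  solutions {d} w b = ∑[ r ∈ allVecs d ] 𝟙 (Vec.map (dot r) w == b)

  relations : Vec (𝔽₂^ d) a → ℕ
  relations {d} {a} w = ∑[ c ∈ allVecs a ] 𝟙 (lincomb c w == zeroVec d)

  oddRelations : Vec (𝔽₂^ (suc d)) a → ℕ
  oddRelations {d} {a} w = ∑[ c ∈ allVecs a ] 𝟙 (dot c (heads w) ∧ (lincomb c (tails w) == zeroVec d))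

  solutions-split : (w : Vec (𝔽₂^ (suc d)) a) (b : 𝔽₂^ a) →
                    solutions w b ≡ solutions (tails w) b + solutions (tails w) (heads w ⊕ b)
  solutions-split {d} w b = trans (∑-allVecs-suc d _)
    (trans (∑-cong (allVecs d) (λ r → cong₂ _+_
              (cong (λ v → 𝟙 (v == b)) (map-dot-false∷ r w))
              (trans (cong (λ v → 𝟙 (v == b)) (map-dot-true∷ r w))
                     (cong 𝟙 (⊕-==-move (heads w) (Vec.map (dot r) (tails w)) b)))))
           (∑-distrib-+ (allVecs d) _ _))

  relations-tails : (w : Vec (𝔽₂^ (suc d)) a) → relations (tails w) ≡ relations w + oddRelations w
  relations-tails {d} {a} w = trans (∑-cong (allVecs a) split) (∑-distrib-+ (allVecs a) _ _)
    where
    𝟙-split-on : ∀ b e → 𝟙 e ≡ 𝟙 (does (b ≟B false) ∧ e) + 𝟙 (b ∧ e)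
    𝟙-split-on false e = sym (+-identityʳ (𝟙 e))
    𝟙-split-on true  e = refl
    split : ∀ c → 𝟙 (lincomb c (tails w) == zeroVec d) ≡
                  𝟙 (lincomb c w == zeroVec (suc d)) + 𝟙 (dot c (heads w) ∧ (lincomb c (tails w) == zeroVec d))
    split c rewrite lincomb-heads-tails c w = 𝟙-split-on (dot c (heads w)) _

  oddRelations≡relations : (w : Vec (𝔽₂^ (suc d)) a) (c₀ : 𝔽₂^ a) →
                           dot c₀ (heads w) ≡ true → lincomb c₀ (tails w) ≡ zeroVec d →
                           oddRelations w ≡ relations w
  oddRelations≡relations {d} {a} w c₀ c₀·heads c₀-relation =
    trans (sym (∑-allVecs-translate a _ c₀)) (∑-cong (allVecs a) translated)
    where
    translated : ∀ c → 𝟙 (dot (c ⊕ c₀) (heads w) ∧ (lincomb (c ⊕ c₀) (tails w) == zeroVec d)) ≡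
                       𝟙 (lincomb c w == zeroVec (suc d))
    translated c = begin
      𝟙 (dot (c ⊕ c₀) (heads w) ∧ (lincomb (c ⊕ c₀) (tails w) == zeroVec d))
        ≡⟨ cong₂ (λ x v → 𝟙 (x ∧ (v == zeroVec d)))
                 (trans (dot-⊕ˡ c c₀ (heads w)) (cong (dot c (heads w) xor_) c₀·heads))
                 (trans (lincomb-⊕ c c₀ (tails w)) (trans (cong (lincomb c (tails w) ⊕_) c₀-relation)
                                                          (⊕-identityʳ (lincomb c (tails w))))) ⟩
      𝟙 ((dot c (heads w) xor true) ∧ (lincomb c (tails w) == zeroVec d))
        ≡⟨ cong (λ x → 𝟙 (x ∧ (lincomb c (tails w) == zeroVec d))) (xor-true (dot c (heads w))) ⟩
      𝟙 ((dot c (heads w) ∷ lincomb c (tails w)) == zeroVec (suc d))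
        ≡⟨ cong (λ v → 𝟙 (v == zeroVec (suc d))) (lincomb-heads-tails c w) ⟨
      𝟙 (lincomb c w == zeroVec (suc d)) ∎
      where
      open ≡-Reasoning
      xor-true : ∀ b → b xor true ≡ does (b ≟B false)
      xor-true false = refl
      xor-true true  = refl

  solutions-relation : (w : Vec (𝔽₂^ d) a) (c₀ : 𝔽₂^ a) {b : 𝔽₂^ a} →
                       lincomb c₀ w ≡ zeroVec d → dot c₀ b ≡ true → solutions w b ≡ 0
  solutions-relation {d} w c₀ {b} c₀-relation c₀·b = ∑-zero (allVecs d) no-solution
    where
    no-solution : ∀ r → 𝟙 (Vec.map (dot r) w == b) ≡ 0
    no-solution r with Vec.map (dot r) w == b in solves
    ... | false = refl
    ... | true  = ⊥-elim (false≢true (begin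
      false                        ≡⟨ dot-zeroʳ r ⟨
      dot r (zeroVec d)            ≡⟨ cong (dot r) c₀-relation ⟨
      dot r (lincomb c₀ w)         ≡⟨ dot-lincomb r c₀ w ⟩
      dot c₀ (Vec.map (dot r) w)   ≡⟨ cong (dot c₀) (==-sound _ _ solves) ⟩
      dot c₀ b                     ≡⟨ c₀·b ⟩
      true                         ∎))
      where open ≡-Reasoning
            false≢true : false ≢ true
            false≢true ()

  solutions-one-branch : (w : Vec (𝔽₂^ (suc d)) a) (c₀ : 𝔽₂^ a) (b : 𝔽₂^ a) →
                         dot c₀ (heads w) ≡ true → lincomb c₀ (tails w) ≡ zeroVec d →
                         ∃ λ b′ → solutions w b ≡ solutions (tails w) b′
  solutions-one-branch w c₀ b c₀·heads c₀-relation with dot c₀ b in c₀·b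
  ... | true  = heads w ⊕ b , trans (solutions-split w b)
    (cong (_+ solutions (tails w) (heads w ⊕ b)) (solutions-relation (tails w) c₀ c₀-relation c₀·b))
  ... | false = b , trans (solutions-split w b)
    (trans (cong (solutions (tails w) b +_) (solutions-relation (tails w) c₀ c₀-relation c₀·[heads⊕b]))
           (+-identityʳ _))
    where
    c₀·[heads⊕b] : dot c₀ (heads w ⊕ b) ≡ true
    c₀·[heads⊕b] = trans (dot-⊕ʳ c₀ (heads w) b) (cong₂ _xor_ c₀·heads c₀·b)

  oddRelations≡0⊎∃ : (w : Vec (𝔽₂^ (suc d)) a) →
                     oddRelations w ≡ 0 ⊎ ∃ λ c₀ → dot c₀ (heads w) ≡ true × lincomb c₀ (tails w) ≡ zeroVec d
  oddRelations≡0⊎∃ {d} {a} w with oddRelations w in odd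
  ... | zero  = inj₁ refl
  ... | suc _ with ∑𝟙>0⇒∃ (allVecs a) _ (subst (0 <_) (sym odd) z<s)
  ... | c₀ , c₀-odd = inj₂ (c₀ , split (dot c₀ (heads w)) c₀-odd)
    where
    split : ∀ x → x ∧ (lincomb c₀ (tails w) == zeroVec d) ≡ true →
            x ≡ true × lincomb c₀ (tails w) ≡ zeroVec d
    split true c₀-relation = refl , ==-sound _ _ c₀-relation

  2^-double : ∀ d x → 2 ^ d * x + 2 ^ d * x ≡ 2 ^ suc d * x
  2^-double d x = trans (sym (*-distribʳ-+ x (2 ^ d) (2 ^ d)))
                        (cong (λ p → (2 ^ d + p) * x) (sym (+-identityʳ (2 ^ d))))

  -- Induction on d, splitting off the first coordinate. If no relation of the tails is odd on
  -- the heads, w and its tails have the same relations and both halves of the split count;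
  -- otherwise the tails have twice as many relations and one half of the split is empty.
  solutions*2^≤2^*relations : ∀ d {a} (w : Vec (𝔽₂^ d) a) (b : 𝔽₂^ a) →
                              solutions w b * 2 ^ a ≤ 2 ^ d * relations w
  solutions*2^≤2^*relations zero {a} w b = begin
    solutions w b * 2 ^ a
      ≤⟨ *-monoˡ-≤ (2 ^ a) (≤-trans (≤-reflexive (+-identityʳ _)) (𝟙≤1 (Vec.map (dot []) w == b))) ⟩
    1 * 2 ^ a
      ≡⟨ cong (1 *_) relations≡2^a ⟨
    1 * relations w ∎
    where
    open ≤-Reasoning
    all-relations : (c : 𝔽₂^ a) → 𝟙 (lincomb c w == []) ≡ 1
    all-relations c with lincomb c w
    ... | [] = refl
    relations≡2^a : relations w ≡ 2 ^ a
    relations≡2^a = trans (∑-cong (allVecs a) all-relations)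
                          (trans (∑-1≡length (allVecs a)) (length-allVecs a))
  solutions*2^≤2^*relations (suc d) {a} w b with oddRelations≡0⊎∃ w
  ... | inj₁ no-odd-relation = begin
    solutions w b * 2 ^ a                         ≡⟨ cong (_* 2 ^ a) (solutions-split w b) ⟩
    (S₁ + S₂) * 2 ^ a                             ≡⟨ *-distribʳ-+ (2 ^ a) S₁ S₂ ⟩
    S₁ * 2 ^ a + S₂ * 2 ^ a                       ≤⟨ +-mono-≤ (solutions*2^≤2^*relations d (tails w) b)
                                                              (solutions*2^≤2^*relations d (tails w) (heads w ⊕ b)) ⟩
    2 ^ d * relations (tails w) + 2 ^ d * relations (tails w)
                                                  ≡⟨ cong (λ x → 2 ^ d * x + 2 ^ d * x) relations-tails≡ ⟩
    2 ^ d * relations w + 2 ^ d * relations w     ≡⟨ 2^-double d (relations w) ⟩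
    2 ^ suc d * relations w                       ∎
    where
    open ≤-Reasoning
    S₁ = solutions (tails w) b
    S₂ = solutions (tails w) (heads w ⊕ b)
    relations-tails≡ : relations (tails w) ≡ relations w
    relations-tails≡ = trans (relations-tails w) (trans (cong (relations w +_) no-odd-relation) (+-identityʳ _))
  ... | inj₂ (c₀ , c₀·heads , c₀-relation) with solutions-one-branch w c₀ b c₀·heads c₀-relation
  ... | b′ , one-branch = begin
    solutions w b * 2 ^ a                      ≡⟨ cong (_* 2 ^ a) one-branch ⟩
    solutions (tails w) b′ * 2 ^ a             ≤⟨ solutions*2^≤2^*relations d (tails w) b′ ⟩
    2 ^ d * relations (tails w)                ≡⟨ cong (2 ^ d *_) (relations-tails w) ⟩
    2 ^ d * (relations w + oddRelations w)
      ≡⟨ cong (λ x → 2 ^ d * (relations w + x)) (oddRelations≡relations w c₀ c₀·heads c₀-relation) ⟩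
    2 ^ d * (relations w + relations w)        ≡⟨ *-distribˡ-+ (2 ^ d) (relations w) (relations w) ⟩
    2 ^ d * relations w + 2 ^ d * relations w  ≡⟨ 2^-double d (relations w) ⟩
    2 ^ suc d * relations w                    ∎
    where open ≤-Reasoning

  spanCount : Vec (𝔽₂^ d) k → 𝔽₂^ d → ℕ
  spanCount {k = k} w x = ∑[ c ∈ allVecs k ] 𝟙 (lincomb c w == x)

  independent : Vec (𝔽₂^ d) k → Bool
  independent []      = true
  independent (x ∷ w) = (spanCount w x ≡ᵇ 0) ∧ independent w

  relations-∷ : (x : 𝔽₂^ d) (w : Vec (𝔽₂^ d) k) → relations (x ∷ w) ≡ relations w + spanCount w x
  relations-∷ {d} {k} x w = trans (∑-allVecs-suc k _)
    (trans (∑-cong (allVecs k) (λ c → cong₂ _+_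
              (cong (λ v → 𝟙 (v == zeroVec d)) (⊕-identityˡ (lincomb c w)))
              (cong 𝟙 (⊕-==-zero x (lincomb c w)))))
           (∑-distrib-+ (allVecs k) _ _))

  relations-independent : (w : Vec (𝔽₂^ d) k) → independent w ≡ true → relations w ≡ 1
  relations-independent {d} []      _     = cong (λ e → 𝟙 e + 0) (==-refl (zeroVec d))
  relations-independent     (x ∷ w) indep with spanCount w x in x∉span | independent w in indep-w
  ... | zero | true = begin
    relations (x ∷ w)              ≡⟨ relations-∷ x w ⟩
    relations w + spanCount w x    ≡⟨ cong (relations w +_) x∉span ⟩
    relations w + 0                ≡⟨ +-identityʳ _ ⟩
    relations w                    ≡⟨ relations-independent w indep-w ⟩
    1                              ∎
    where open ≡-Reasoning

  solutions-independent : ∀ d {a} (w : Vec (𝔽₂^ d) a) (b : 𝔽₂^ a) → independent w ≡ true →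
                          solutions w b * 2 ^ a ≤ 2 ^ d
  solutions-independent d {a} w b indep = begin
    solutions w b * 2 ^ a   ≤⟨ solutions*2^≤2^*relations d w b ⟩
    2 ^ d * relations w     ≡⟨ cong (2 ^ d *_) (relations-independent w indep) ⟩
    2 ^ d * 1               ≡⟨ *-identityʳ (2 ^ d) ⟩
    2 ^ d                   ∎
    where open ≤-Reasoning

  sendsAllTo : ∀ {ℓ} → LinMap d ℓ → Vec (𝔽₂^ d) k → 𝔽₂^ ℓ → Bool
  sendsAllTo h []      y = true
  sendsAllTo h (x ∷ w) y = (apply h x == y) ∧ sendsAllTo h w y

  sendsAllTo-∷ : ∀ {ℓ} (r : 𝔽₂^ d) (h : LinMap d ℓ) (w : Vec (𝔽₂^ d) k) (b : Bool) (y : 𝔽₂^ ℓ) →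
                 sendsAllTo (r ∷ h) w (b ∷ y) ≡
                 (Vec.map (dot r) w == Vec.replicate k b) ∧ sendsAllTo h w y
  sendsAllTo-∷ r h []      b y = refl
  sendsAllTo-∷ r h (x ∷ w) b y =
    trans (cong ((row ∧ rest) ∧_) (sendsAllTo-∷ r h w b y))
          (∧-interchange row rest (Vec.map (dot r) w == Vec.replicate _ b) (sendsAllTo h w y))
    where
    row  = does (dot r x ≟B b)
    rest = apply h x == y

  mapsSendingAllTo*2^≤2^ : ∀ d ℓ {a} (w : Vec (𝔽₂^ d) a) (y : 𝔽₂^ ℓ) → independent w ≡ true →
                           (∑[ h ∈ allLinMaps d ℓ ] 𝟙 (sendsAllTo h w y)) * 2 ^ (ℓ * a) ≤ 2 ^ (ℓ * d)
  mapsSendingAllTo*2^≤2^ d zero    w []      indep =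
    ≤-trans (≤-reflexive (trans (*-identityʳ _) (+-identityʳ _))) (𝟙≤1 (sendsAllTo [] w []))
  mapsSendingAllTo*2^≤2^ d (suc ℓ) {a} w (b ∷ y) indep = begin
    S * 2 ^ (a + ℓ * a)                        ≡⟨ cong₂ _*_ S≡N*S′ (^-distribˡ-+-* 2 a (ℓ * a)) ⟩
    (N * S′) * (2 ^ a * 2 ^ (ℓ * a))           ≡⟨ *-interchange N S′ (2 ^ a) (2 ^ (ℓ * a)) ⟩
    (N * 2 ^ a) * (S′ * 2 ^ (ℓ * a))           ≤⟨ *-mono-≤ (solutions-independent d w (Vec.replicate a b) indep)
                                                           (mapsSendingAllTo*2^≤2^ d ℓ w y indep) ⟩
    2 ^ d * 2 ^ (ℓ * d)                        ≡⟨ ^-distribˡ-+-* 2 d (ℓ * d) ⟨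
    2 ^ (d + ℓ * d)                            ∎
    where
    open ≤-Reasoning
    S  = ∑[ h ∈ allLinMaps d (suc ℓ) ] 𝟙 (sendsAllTo h w (b ∷ y))
    S′ = ∑[ h ∈ allLinMaps d ℓ ] 𝟙 (sendsAllTo h w y)
    N  = solutions w (Vec.replicate a b)
    S≡N*S′ : S ≡ N * S′
    S≡N*S′ = begin-equality
      S                                                               ≡⟨ ∑-allVecsOf-suc (allVecs d) ℓ _ ⟩
      ∑[ h ∈ allLinMaps d ℓ ] ∑[ r ∈ allVecs d ] 𝟙 (sendsAllTo (r ∷ h) w (b ∷ y))
        ≡⟨ ∑-cong (allLinMaps d ℓ) (λ h → ∑-cong (allVecs d) (λ r →
             trans (cong 𝟙 (sendsAllTo-∷ r h w b y)) (𝟙-∧ _ (sendsAllTo h w y)))) ⟩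
      ∑[ h ∈ allLinMaps d ℓ ] ∑[ r ∈ allVecs d ]
        (𝟙 (Vec.map (dot r) w == Vec.replicate a b) * 𝟙 (sendsAllTo h w y))
        ≡⟨ ∑-cong (allLinMaps d ℓ) (λ h → ∑-*ʳ (allVecs d) _ (𝟙 (sendsAllTo h w y))) ⟩
      ∑[ h ∈ allLinMaps d ℓ ] (N * 𝟙 (sendsAllTo h w y))              ≡⟨ ∑-*ˡ (allLinMaps d ℓ) _ N ⟩
      N * S′                                                          ∎

module FibreFrames where

  open import Defs
  open FiniteSums
  open 𝔽₂Vectors
  open Solutions
  open import Data.Bool using (Bool; true; false; _∧_)
  open import Data.Bool.Properties using (∧-commutativeMonoid)
  open import Data.Nat
  open import Data.Nat.Properties
  open import Data.List using (allFin; length; filter)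
  open import Data.List.Properties using (length-tabulate)
  open import Data.Vec as Vec using (Vec; _∷_; lookup)
  open import Data.Fin using (Fin; zero; suc)
  import Data.Fin.Properties as Fin
  open import Data.Empty using (⊥-elim)
  open import Function using (_∘_; id)
  open import Function.Definitions using (Injective)
  open import Relation.Binary.PropositionalEquality
  open import Relation.Nullary using (¬_; Dec; does; yes; no)
  open import Algebra.Bundles using (CommutativeMonoid)
  open import Algebra.Properties.CommutativeSemigroup (CommutativeMonoid.commutativeSemigroup ∧-commutativeMonoid)
    using () renaming (interchange to ∧-interchange)

  ∑-allVecs<2^ : ∀ k (g : 𝔽₂^ k → ℕ) → (∀ c → g c ≤ 1) → g (zeroVec k) ≡ 0 → ∑ (allVecs k) g < 2 ^ k
  ∑-allVecs<2^ zero    g g≤1 g0≡0 rewrite g0≡0 = s≤s z≤n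
  ∑-allVecs<2^ (suc k) g g≤1 g0≡0 = begin-strict
    ∑ (allVecs (suc k)) g
      ≡⟨ trans (∑-allVecs-suc k g) (∑-distrib-+ (allVecs k) _ _) ⟩
    (∑[ c ∈ allVecs k ] g (false ∷ c)) + (∑[ c ∈ allVecs k ] g (true ∷ c))
      <⟨ +-mono-<-≤ (∑-allVecs<2^ k (λ c → g (false ∷ c)) (λ c → g≤1 (false ∷ c)) g0≡0)
                    (∑-mono-≤ (allVecs k) (λ c → g≤1 (true ∷ c))) ⟩
    2 ^ k + ∑[ c ∈ allVecs k ] 1
      ≡⟨ cong (2 ^ k +_) (trans (∑-1≡length (allVecs k)) (length-allVecs k)) ⟩
    2 ^ k + 2 ^ k
      ≡⟨ cong (2 ^ k +_) (+-identityʳ (2 ^ k)) ⟨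
    2 ^ suc k ∎
    where open ≤-Reasoning

  ∑𝟙-injective≤1 : ∀ {d} m (f : Fin m → 𝔽₂^ d) → Injective _≡_ _≡_ f → (v : 𝔽₂^ d) →
                   ∑[ i ∈ allFin m ] 𝟙 (v == f i) ≤ 1
  ∑𝟙-injective≤1 zero    f f-inj v = z≤n
  ∑𝟙-injective≤1 (suc m) f f-inj v rewrite ∑-allFin-suc m (λ i → 𝟙 (v == f i)) with v == f zero in v≡f0
  ... | false = ∑𝟙-injective≤1 m (f ∘ suc) (Fin.suc-injective ∘ f-inj) v
  ... | true  = ≤-reflexive (cong suc (∑-zero (allFin m) v≢f[1+i]))
    where
    v≢f[1+i] : ∀ i → 𝟙 (v == f (suc i)) ≡ 0
    v≢f[1+i] i with v == f (suc i) in v≡f[1+i]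
    ... | false = refl
    ... | true  = ⊥-elim (Fin.0≢1+n (f-inj (trans (sym (==-sound v (f zero) v≡f0))
                                                  (==-sound v (f (suc i)) v≡f[1+i]))))

  -- The number of ordered linearly independent k-tuples in 𝔽₂^a.
  frameCount : ℕ → ℕ → ℕ
  frameCount a zero    = 1
  frameCount a (suc k) = frameCount a k * (2 ^ a ∸ 2 ^ k)

  module Fibre {d ℓ m : ℕ} (us : Vec (𝔽₂^ d) m) (us-injective : Injective _≡_ _≡_ (lookup us))
               (us-nonzero : ∀ i → ¬ (lookup us i ≡ zeroVec d)) (y : 𝔽₂^ ℓ) where

    inFibre : LinMap d ℓ → Fin m → Bool
    inFibre h i = apply h (lookup us i) == y

    fibreSize : LinMap d ℓ → ℕ
    fibreSize h = ∑[ i ∈ allFin m ] 𝟙 (inFibre h i)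

    Z≡fibreSize : ∀ h → Z us h y ≡ fibreSize h
    Z≡fibreSize h = length-filter≡∑𝟙 (λ i → apply h (lookup us i) ≟V y) (allFin m)

    ∑-spanCount<2^ : ∀ {k} (w : Vec (𝔽₂^ d) k) → ∑[ i ∈ allFin m ] spanCount w (lookup us i) < 2 ^ k
    ∑-spanCount<2^ {k} w = begin-strict
      ∑[ i ∈ allFin m ] spanCount w (lookup us i)
        ≡⟨ ∑-comm (allFin m) (allVecs k) (λ i c → 𝟙 (lincomb c w == lookup us i)) ⟩
      ∑ (allVecs k) hits
        <⟨ ∑-allVecs<2^ k hits hits≤1 zero-hits-nothing ⟩
      2 ^ k ∎
      where
      open ≤-Reasoning
      hits : 𝔽₂^ k → ℕ
      hits c = ∑[ i ∈ allFin m ] 𝟙 (lincomb c w == lookup us i)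
      hits≤1 : ∀ c → hits c ≤ 1
      hits≤1 c = ∑𝟙-injective≤1 m (lookup us) us-injective (lincomb c w)
      zero-hits-nothing : hits (zeroVec k) ≡ 0
      zero-hits-nothing rewrite lincomb-zero {d} w = ∑-zero (allFin m) misses
        where
        misses : ∀ i → 𝟙 (zeroVec d == lookup us i) ≡ 0
        misses i with zeroVec d == lookup us i in hit
        ... | false = refl
        ... | true  = ⊥-elim (us-nonzero i (sym (==-sound _ _ hit)))

    outsideSpanInFibre : ∀ {k} → LinMap d ℓ → Vec (𝔽₂^ d) k → Fin m → Bool
    outsideSpanInFibre h w i = (spanCount w (lookup us i) ≡ᵇ 0) ∧ inFibre h i

    extensions : ∀ {k} → LinMap d ℓ → Vec (𝔽₂^ d) k → ℕ
    extensions h w = ∑[ i ∈ allFin m ] 𝟙 (outsideSpanInFibre h w i)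

    fibreSize≤extensions+∑spanCount : ∀ {k} h (w : Vec (𝔽₂^ d) k) →
      fibreSize h ≤ extensions h w + ∑[ i ∈ allFin m ] spanCount w (lookup us i)
    fibreSize≤extensions+∑spanCount h w = ≤-trans
      (∑-mono-≤ (allFin m) (λ i → 𝟙≤𝟙[≡ᵇ0∧]+ (spanCount w (lookup us i)) (inFibre h i)))
      (≤-reflexive (∑-distrib-+ (allFin m) _ _))
      where
      𝟙≤𝟙[≡ᵇ0∧]+ : ∀ n e → 𝟙 e ≤ 𝟙 ((n ≡ᵇ 0) ∧ e) + n
      𝟙≤𝟙[≡ᵇ0∧]+ zero    e = ≤-reflexive (sym (+-identityʳ (𝟙 e)))
      𝟙≤𝟙[≡ᵇ0∧]+ (suc n) e = ≤-trans (𝟙≤1 e) (s≤s z≤n)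

    extensions-lower : ∀ {k} a h (w : Vec (𝔽₂^ d) k) → 2 ^ a ≤ suc (fibreSize h) → 2 ^ a ∸ 2 ^ k ≤ extensions h w
    extensions-lower {k} a h w 2^a≤ = m≤n+o⇒m∸n≤o (2 ^ a) (2 ^ k) (begin
      2 ^ a                                                      ≤⟨ 2^a≤ ⟩
      suc (fibreSize h)                                          ≤⟨ s≤s (fibreSize≤extensions+∑spanCount h w) ⟩
      suc (extensions h w + ∑[ i ∈ allFin m ] spanCount w (lookup us i))
                                                                 ≡⟨ +-suc (extensions h w) _ ⟨
      extensions h w + suc (∑[ i ∈ allFin m ] spanCount w (lookup us i))
                                                                 ≤⟨ +-monoʳ-≤ (extensions h w) (∑-spanCount<2^ w) ⟩
      extensions h w + 2 ^ k                                     ≡⟨ +-comm (extensions h w) (2 ^ k) ⟩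
      2 ^ k + extensions h w                                     ∎)
      where open ≤-Reasoning

    vectors : ∀ {k} → Vec (Fin m) k → Vec (𝔽₂^ d) k
    vectors = Vec.map (lookup us)

    isFibreFrame : ∀ {k} → LinMap d ℓ → Vec (Fin m) k → Bool
    isFibreFrame h t = independent (vectors t) ∧ sendsAllTo h (vectors t) y

    fibreFrames : LinMap d ℓ → ℕ → ℕ
    fibreFrames h k = ∑[ t ∈ allVecsOf (allFin m) k ] 𝟙 (isFibreFrame h t)

    𝟙-isFibreFrame-∷ : ∀ {k} h i (t : Vec (Fin m) k) →
      𝟙 (isFibreFrame h (i ∷ t)) ≡ 𝟙 (isFibreFrame h t) * 𝟙 (outsideSpanInFibre h (vectors t) i)
    𝟙-isFibreFrame-∷ h i t = trans
      (cong 𝟙 (∧-interchange (spanCount (vectors t) (lookup us i) ≡ᵇ 0) (independent (vectors t))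
                             (inFibre h i) (sendsAllTo h (vectors t) y)))
      (trans (𝟙-∧ (outsideSpanInFibre h (vectors t) i) (isFibreFrame h t))
             (*-comm (𝟙 (outsideSpanInFibre h (vectors t) i)) (𝟙 (isFibreFrame h t))))

    fibreFrames-suc : ∀ h k →
      fibreFrames h (suc k) ≡ ∑[ t ∈ allVecsOf (allFin m) k ] (𝟙 (isFibreFrame h t) * extensions h (vectors t))
    fibreFrames-suc h k = trans (∑-allVecsOf-suc (allFin m) k _) (∑-cong (allVecsOf (allFin m) k) (λ t →
      trans (∑-cong (allFin m) (λ i → 𝟙-isFibreFrame-∷ h i t)) (∑-*ˡ (allFin m) _ (𝟙 (isFibreFrame h t)))))

    frameCount≤fibreFrames : ∀ a k h → 2 ^ a ≤ suc (fibreSize h) → frameCount a k ≤ fibreFrames h k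
    frameCount≤fibreFrames a zero    h 2^a≤ = ≤-refl
    frameCount≤fibreFrames a (suc k) h 2^a≤ = begin
      frameCount a k * (2 ^ a ∸ 2 ^ k)
        ≤⟨ *-monoˡ-≤ _ (frameCount≤fibreFrames a k h 2^a≤) ⟩
      fibreFrames h k * (2 ^ a ∸ 2 ^ k)
        ≡⟨ ∑-*ʳ (allVecsOf (allFin m) k) _ _ ⟨
      ∑[ t ∈ allVecsOf (allFin m) k ] (𝟙 (isFibreFrame h t) * (2 ^ a ∸ 2 ^ k))
        ≤⟨ ∑-mono-≤ (allVecsOf (allFin m) k) (λ t →
             *-monoʳ-≤ (𝟙 (isFibreFrame h t)) (extensions-lower a h (vectors t) 2^a≤)) ⟩
      ∑[ t ∈ allVecsOf (allFin m) k ] (𝟙 (isFibreFrame h t) * extensions h (vectors t))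
        ≡⟨ fibreFrames-suc h k ⟨
      fibreFrames h (suc k) ∎
      where open ≤-Reasoning

    mapsWithFibreFrame*2^≤2^ : ∀ {a} (t : Vec (Fin m) a) →
      (∑[ h ∈ allLinMaps d ℓ ] 𝟙 (isFibreFrame h t)) * 2 ^ (ℓ * a) ≤ 2 ^ (ℓ * d)
    mapsWithFibreFrame*2^≤2^ t with independent (vectors t) in indep
    ... | true  = mapsSendingAllTo*2^≤2^ d ℓ (vectors t) y indep
    ... | false rewrite ∑-zero (allLinMaps d ℓ) {λ _ → 0} (λ _ → refl) = z≤n

    ∑fibreFrames*2^≤ : ∀ a → (∑[ h ∈ allLinMaps d ℓ ] fibreFrames h a) * 2 ^ (ℓ * a) ≤ m ^ a * 2 ^ (ℓ * d)
    ∑fibreFrames*2^≤ a = begin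
      (∑[ h ∈ allLinMaps d ℓ ] fibreFrames h a) * 2 ^ (ℓ * a)
        ≡⟨ cong (_* 2 ^ (ℓ * a)) (∑-comm (allLinMaps d ℓ) (allVecsOf (allFin m) a) (λ h t → 𝟙 (isFibreFrame h t))) ⟩
      (∑[ t ∈ allVecsOf (allFin m) a ] ∑[ h ∈ allLinMaps d ℓ ] 𝟙 (isFibreFrame h t)) * 2 ^ (ℓ * a)
        ≡⟨ ∑-*ʳ (allVecsOf (allFin m) a) _ _ ⟨
      ∑[ t ∈ allVecsOf (allFin m) a ] ((∑[ h ∈ allLinMaps d ℓ ] 𝟙 (isFibreFrame h t)) * 2 ^ (ℓ * a))
        ≤⟨ ∑-mono-≤ (allVecsOf (allFin m) a) mapsWithFibreFrame*2^≤2^ ⟩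
      ∑[ t ∈ allVecsOf (allFin m) a ] (2 ^ (ℓ * d))
        ≡⟨ ∑-const (allVecsOf (allFin m) a) _ ⟩
      length (allVecsOf (allFin m) a) * 2 ^ (ℓ * d)
        ≡⟨ cong (_* 2 ^ (ℓ * d)) (trans (length-allVecsOf (allFin m) a) (cong (_^ a) (length-tabulate id))) ⟩
      m ^ a * 2 ^ (ℓ * d) ∎
      where open ≤-Reasoning

    largeFibres*frameCount*2^≤ : ∀ a → 1 ≤ a →
      length (filter (λ h → 2 ^ a ∸ 2 <? Z us h y) (allLinMaps d ℓ)) * frameCount a a * 2 ^ (ℓ * a)
        ≤ m ^ a * 2 ^ (ℓ * d)
    largeFibres*frameCount*2^≤ a 1≤a = begin
      length (filter large? (allLinMaps d ℓ)) * frameCount a a * 2 ^ (ℓ * a)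
        ≡⟨ cong (λ n → n * frameCount a a * 2 ^ (ℓ * a)) (length-filter≡∑𝟙 large? (allLinMaps d ℓ)) ⟩
      (∑[ h ∈ allLinMaps d ℓ ] 𝟙 (does (large? h))) * frameCount a a * 2 ^ (ℓ * a)
        ≡⟨ cong (_* 2 ^ (ℓ * a)) (∑-*ʳ (allLinMaps d ℓ) _ _) ⟨
      (∑[ h ∈ allLinMaps d ℓ ] (𝟙 (does (large? h)) * frameCount a a)) * 2 ^ (ℓ * a)
        ≤⟨ *-monoˡ-≤ (2 ^ (ℓ * a)) (∑-mono-≤ (allLinMaps d ℓ) (λ h → large⇒frames h (large? h))) ⟩
      (∑[ h ∈ allLinMaps d ℓ ] fibreFrames h a) * 2 ^ (ℓ * a)
        ≤⟨ ∑fibreFrames*2^≤ a ⟩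
      m ^ a * 2 ^ (ℓ * d) ∎
      where
      open ≤-Reasoning
      large? : ∀ h → Dec (2 ^ a ∸ 2 < Z us h y)
      large? h = 2 ^ a ∸ 2 <? Z us h y
      2^a≤ : ∀ h → 2 ^ a ∸ 2 < Z us h y → 2 ^ a ≤ suc (fibreSize h)
      2^a≤ h large = begin
        2 ^ a                 ≡⟨ m∸n+n≡m (^-monoʳ-≤ 2 1≤a) ⟨
        2 ^ a ∸ 2 + 2         ≡⟨ +-comm (2 ^ a ∸ 2) 2 ⟩
        suc (suc (2 ^ a ∸ 2)) ≤⟨ s≤s large ⟩
        suc (Z us h y)        ≡⟨ cong suc (Z≡fibreSize h) ⟩
        suc (fibreSize h)     ∎
      large⇒frames : ∀ h (l : Dec (2 ^ a ∸ 2 < Z us h y)) → 𝟙 (does l) * frameCount a a ≤ fibreFrames h a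
      large⇒frames h (no _)      = z≤n
      large⇒frames h (yes large) = ≤-trans (≤-reflexive (*-identityˡ _)) (frameCount≤fibreFrames a a h (2^a≤ h large))

module DyadicRationals where

  open import Defs
  open import Data.Nat as ℕ using (ℕ; zero; suc; _^_; _∸_; NonZero)
  import Data.Nat.Properties as ℕ
  open import Data.Integer as ℤ using (+_)
  import Data.Integer.Properties as ℤ
  open import Data.Rational as ℚ using (ℚ; 1ℚ; ½; toℚᵘ)
  import Data.Rational.Properties as ℚ
  open import Data.Rational.Unnormalised as ℚᵘ using (*≡*; *≤*) renaming (_/_ to _/ᵘ_)
  import Data.Rational.Unnormalised.Properties as ℚᵘ
  open import Relation.Binary.PropositionalEquality

  toℚᵘ-/ : ∀ n D .{{_ : NonZero D}} → toℚᵘ (+ n ℚ./ D) ℚᵘ.≃ + n /ᵘ D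
  toℚᵘ-/ n (suc D) = ℚ.toℚᵘ-fromℚᵘ (ℚᵘ.mkℚᵘ (+ n) D)

  /ᵘ-cong : ∀ {a a′ b b′} .{{_ : NonZero b}} .{{_ : NonZero b′}} →
            a ≡ a′ → b ≡ b′ → + a /ᵘ b ℚᵘ.≃ + a′ /ᵘ b′
  /ᵘ-cong {b = suc b} refl refl = ℚᵘ.≃-refl

  /ᵘ-* : ∀ a b c e .{{_ : NonZero b}} .{{_ : NonZero e}} →
         (+ a /ᵘ b) ℚᵘ.* (+ c /ᵘ e) ℚᵘ.≃ (+ (a ℕ.* c) /ᵘ (b ℕ.* e)) {{ℕ.m*n≢0 b e}}
  /ᵘ-* a (suc b) c (suc e) = *≡* (cong (ℤ._* (+ (suc b ℕ.* suc e))) (sym (ℤ.pos-* a c)))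

  /ᵘ-≤ : ∀ a b c e .{{_ : NonZero b}} .{{_ : NonZero e}} →
         a ℕ.* e ℕ.≤ c ℕ.* b → + a /ᵘ b ℚᵘ.≤ + c /ᵘ e
  /ᵘ-≤ a (suc b) c (suc e) ae≤cb =
    *≤* (subst₂ ℤ._≤_ (ℤ.pos-* a (suc e)) (ℤ.pos-* c (suc b)) (ℤ.+≤+ ae≤cb))

  1-1/ᵘ : ∀ D .{{_ : NonZero D}} → ℚᵘ.1ℚᵘ ℚᵘ.- + 1 /ᵘ D ℚᵘ.≃ + (D ∸ 1) /ᵘ D
  1-1/ᵘ (suc D) = *≡* (cong₂ ℤ._*_ (cong (ℤ._+ ℤ.- + 1) (ℤ.*-identityˡ (+ suc D)))
                                   (cong (λ n → + suc n) (sym (ℕ.+-identityʳ D))))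

  infix 4 _≃_/2^_

  -- A record rather than a definition, so that n and k can be inferred (2 ^_ is not injective).
  record _≃_/2^_ (q : ℚ) (n k : ℕ) : Set where
    constructor dyadic
    field toℚᵘ-≃ : toℚᵘ q ℚᵘ.≃ (+ n /ᵘ 2 ^ k) {{ℕ.m^n≢0 2 k}}

  /2^-dyadic : ∀ n k → (+ n ℚ./ 2 ^ k) {{ℕ.m^n≢0 2 k}} ≃ n /2^ k
  /2^-dyadic n k = dyadic (toℚᵘ-/ n (2 ^ k) {{ℕ.m^n≢0 2 k}})

  dyadic-cong : ∀ {q n n′ k k′} → q ≃ n /2^ k → n ≡ n′ → k ≡ k′ → q ≃ n′ /2^ k′
  dyadic-cong {k = k} {k′} (dyadic q≃) n≡n′ k≡k′ = dyadic (
    ℚᵘ.≃-trans q≃ (/ᵘ-cong {{ℕ.m^n≢0 2 k}} {{ℕ.m^n≢0 2 k′}} n≡n′ (cong (2 ^_) k≡k′)))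

  *-dyadic : ∀ {p q n n′ k k′} → p ≃ n /2^ k → q ≃ n′ /2^ k′ → p ℚ.* q ≃ n ℕ.* n′ /2^ (k ℕ.+ k′)
  *-dyadic {p} {q} {n} {n′} {k} {k′} (dyadic p≃) (dyadic q≃) = dyadic (begin
    toℚᵘ (p ℚ.* q)
      ≈⟨ ℚ.toℚᵘ-homo-* p q ⟩
    toℚᵘ p ℚᵘ.* toℚᵘ q
      ≈⟨ ℚᵘ.*-cong p≃ q≃ ⟩
    (+ n /ᵘ 2 ^ k) ℚᵘ.* (+ n′ /ᵘ 2 ^ k′)
      ≈⟨ /ᵘ-* n (2 ^ k) n′ (2 ^ k′) ⟩
    (+ (n ℕ.* n′) /ᵘ (2 ^ k ℕ.* 2 ^ k′)) {{ℕ.m*n≢0 (2 ^ k) (2 ^ k′)}}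
      ≈⟨ /ᵘ-cong {{ℕ.m*n≢0 (2 ^ k) (2 ^ k′)}} refl (sym (ℕ.^-distribˡ-+-* 2 k k′)) ⟩
    + (n ℕ.* n′) /ᵘ 2 ^ (k ℕ.+ k′) ∎)
    where
    open ℚᵘ.≃-Reasoning
    instance
      _ : NonZero (2 ^ k)
      _ = ℕ.m^n≢0 2 k
      _ : NonZero (2 ^ k′)
      _ = ℕ.m^n≢0 2 k′
      _ : NonZero (2 ^ (k ℕ.+ k′))
      _ = ℕ.m^n≢0 2 (k ℕ.+ k′)

  ^ℚ-dyadic : ∀ {q n k} j → q ≃ n /2^ k → q ^ℚ j ≃ n ^ j /2^ (j ℕ.* k)
  ^ℚ-dyadic zero    q≃ = dyadic ℚᵘ.≃-refl
  ^ℚ-dyadic (suc j) q≃ = *-dyadic q≃ (^ℚ-dyadic j q≃)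

  ½^-dyadic : ∀ j → ½ ^ℚ j ≃ 1 /2^ j
  ½^-dyadic j = dyadic-cong (^ℚ-dyadic j (dyadic ℚᵘ.≃-refl)) (ℕ.^-zeroˡ j) (ℕ.*-identityʳ j)

  1-dyadic : ∀ {q} k → q ≃ 1 /2^ k → 1ℚ ℚ.- q ≃ 2 ^ k ∸ 1 /2^ k
  1-dyadic {q} k (dyadic q≃) = dyadic (begin
    toℚᵘ (1ℚ ℚ.- q)
      ≈⟨ ℚ.toℚᵘ-homo-+ 1ℚ (ℚ.- q) ⟩
    toℚᵘ 1ℚ ℚᵘ.+ toℚᵘ (ℚ.- q)
      ≈⟨ ℚᵘ.+-congʳ (toℚᵘ 1ℚ) (ℚᵘ.≃-trans (ℚ.toℚᵘ-homo‿- q) (ℚᵘ.-‿cong q≃)) ⟩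
    ℚᵘ.1ℚᵘ ℚᵘ.- + 1 /ᵘ 2 ^ k
      ≈⟨ 1-1/ᵘ (2 ^ k) ⟩
    + (2 ^ k ∸ 1) /ᵘ 2 ^ k ∎)
    where
    open ℚᵘ.≃-Reasoning
    instance
      _ : NonZero (2 ^ k)
      _ = ℕ.m^n≢0 2 k

  ≤-dyadic : ∀ {p q n n′ k k′} → p ≃ n /2^ k → q ≃ n′ /2^ k′ →
             n ℕ.* 2 ^ k′ ℕ.≤ n′ ℕ.* 2 ^ k → p ℚ.≤ q
  ≤-dyadic {k = k} {k′} (dyadic p≃) (dyadic q≃) cross = ℚ.toℚᵘ-cancel-≤
    (ℚᵘ.≤-respˡ-≃ (ℚᵘ.≃-sym p≃) (ℚᵘ.≤-respʳ-≃ (ℚᵘ.≃-sym q≃)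
      (/ᵘ-≤ _ (2 ^ k) _ (2 ^ k′) {{ℕ.m^n≢0 2 k}} {{ℕ.m^n≢0 2 k′}} cross)))

module PartialProducts where

  open import Defs
  open DyadicRationals
  open FibreFrames using (frameCount; module Fibre)
  open import Data.Nat
  open import Data.Nat.Properties
  open import Data.Nat.Tactic.RingSolver using (solve-∀)
  open import Data.List using (length; filter)
  open import Data.Vec using (Vec; lookup)
  open import Function.Definitions using (Injective)
  open import Relation.Binary.PropositionalEquality
  open import Relation.Nullary using (¬_)

  P-numerator : ℕ → ℕ
  P-numerator zero    = 1
  P-numerator (suc a) = P-numerator a * (2 ^ suc a ∸ 1)

  triangular : ℕ → ℕ
  triangular zero    = 0
  triangular (suc a) = triangular a + suc a

  P-dyadic : ∀ a → P a ≃ P-numerator a /2^ triangular a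
  P-dyadic zero    = /2^-dyadic 1 0
  P-dyadic (suc a) = *-dyadic (P-dyadic a) (1-dyadic (suc a) (½^-dyadic (suc a)))

  frameCount-suc : ∀ a k → frameCount (suc a) (suc k) ≡ (2 ^ suc a ∸ 1) * 2 ^ k * frameCount a k
  frameCount-suc a zero    = trans (*-identityˡ _) (sym (trans (*-identityʳ _) (*-identityʳ _)))
  frameCount-suc a (suc k) = begin
    frameCount (suc a) (suc k) * (2 ^ suc a ∸ 2 ^ suc k)
      ≡⟨ cong₂ _*_ (frameCount-suc a k) (sym (*-distribˡ-∸ 2 (2 ^ a) (2 ^ k))) ⟩
    ((2 ^ suc a ∸ 1) * 2 ^ k * frameCount a k) * (2 * (2 ^ a ∸ 2 ^ k))
      ≡⟨ rearrange (2 ^ suc a ∸ 1) (2 ^ k) (frameCount a k) (2 ^ a ∸ 2 ^ k) ⟩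
    (2 ^ suc a ∸ 1) * (2 * 2 ^ k) * (frameCount a k * (2 ^ a ∸ 2 ^ k)) ∎
    where
    open ≡-Reasoning
    rearrange : ∀ A p f δ → (A * p * f) * (2 * δ) ≡ A * (2 * p) * (f * δ)
    rearrange = solve-∀

  P-numerator*2^[a*a]≡frameCount*2^triangular : ∀ a → P-numerator a * 2 ^ (a * a) ≡ frameCount a a * 2 ^ triangular a
  P-numerator*2^[a*a]≡frameCount*2^triangular zero    = refl
  P-numerator*2^[a*a]≡frameCount*2^triangular (suc a) = begin
    P-numerator a * A * 2 ^ (suc a * suc a)
      ≡⟨ cong (λ e → P-numerator a * A * 2 ^ e) (square-suc a) ⟩
    P-numerator a * A * 2 ^ (a * a + (a + suc a))
      ≡⟨ cong (P-numerator a * A *_) (trans (^-distribˡ-+-* 2 (a * a) (a + suc a))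
                                            (cong (2 ^ (a * a) *_) (^-distribˡ-+-* 2 a (suc a)))) ⟩
    P-numerator a * A * (2 ^ (a * a) * (2 ^ a * 2 ^ suc a))
      ≡⟨ rearrange₁ (P-numerator a) A (2 ^ (a * a)) (2 ^ a) (2 ^ suc a) ⟩
    A * 2 ^ a * 2 ^ suc a * (P-numerator a * 2 ^ (a * a))
      ≡⟨ cong (A * 2 ^ a * 2 ^ suc a *_) (P-numerator*2^[a*a]≡frameCount*2^triangular a) ⟩
    A * 2 ^ a * 2 ^ suc a * (frameCount a a * 2 ^ triangular a)
      ≡⟨ rearrange₂ A (2 ^ a) (2 ^ suc a) (frameCount a a) (2 ^ triangular a) ⟩
    (A * 2 ^ a * frameCount a a) * (2 ^ triangular a * 2 ^ suc a)
      ≡⟨ cong₂ _*_ (frameCount-suc a a) (^-distribˡ-+-* 2 (triangular a) (suc a)) ⟨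
    frameCount (suc a) (suc a) * 2 ^ (triangular a + suc a) ∎
    where
    open ≡-Reasoning
    A = 2 ^ suc a ∸ 1
    square-suc : ∀ a → suc a * suc a ≡ a * a + (a + suc a)
    square-suc = solve-∀
    rearrange₁ : ∀ Q A s p q → Q * A * (s * (p * q)) ≡ A * p * q * (Q * s)
    rearrange₁ = solve-∀
    rearrange₂ : ∀ A p q f t → A * p * q * (f * t) ≡ (A * p * f) * (t * q)
    rearrange₂ = solve-∀

  -- Stated in the shape in which the dyadic forms of the two sides of the theorem arrive.
  largeFibres-cross-multiplied : ∀ {d ℓ m} (us : Vec (𝔽₂^ d) m) → Injective _≡_ _≡_ (lookup us) →
    (∀ i → ¬ (lookup us i ≡ zeroVec d)) → (y : 𝔽₂^ ℓ) → ∀ a → a ≥ 1 →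
    length (filter (λ h → 2 ^ a ∸ 2 <? Z us h y) (allLinMaps d ℓ)) * P-numerator a * 2 ^ (a * ℓ + a * a)
      ≤ m ^ a * 1 * 2 ^ (ℓ * d + triangular a)
  largeFibres-cross-multiplied {d} {ℓ} {m} us us-injective us-nonzero y a a≥1 = begin
    C * P-numerator a * 2 ^ (a * ℓ + a * a)
      ≡⟨ cong (C * P-numerator a *_) (^-distribˡ-+-* 2 (a * ℓ) (a * a)) ⟩
    C * P-numerator a * (2 ^ (a * ℓ) * 2 ^ (a * a))
      ≡⟨ cong (λ e → C * P-numerator a * (2 ^ e * 2 ^ (a * a))) (*-comm a ℓ) ⟩
    C * P-numerator a * (2 ^ (ℓ * a) * 2 ^ (a * a))
      ≡⟨ rearrange₁ C (P-numerator a) (2 ^ (ℓ * a)) (2 ^ (a * a)) ⟩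
    C * 2 ^ (ℓ * a) * (P-numerator a * 2 ^ (a * a))
      ≡⟨ cong (C * 2 ^ (ℓ * a) *_) (P-numerator*2^[a*a]≡frameCount*2^triangular a) ⟩
    C * 2 ^ (ℓ * a) * (frameCount a a * 2 ^ triangular a)
      ≡⟨ rearrange₂ C (2 ^ (ℓ * a)) (frameCount a a) (2 ^ triangular a) ⟩
    C * frameCount a a * 2 ^ (ℓ * a) * 2 ^ triangular a
      ≤⟨ *-monoˡ-≤ (2 ^ triangular a) (Fibre.largeFibres*frameCount*2^≤ us us-injective us-nonzero y a a≥1) ⟩
    m ^ a * 2 ^ (ℓ * d) * 2 ^ triangular a
      ≡⟨ rearrange₃ (m ^ a) (2 ^ (ℓ * d)) (2 ^ triangular a) ⟩
    m ^ a * 1 * (2 ^ (ℓ * d) * 2 ^ triangular a)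
      ≡⟨ cong (m ^ a * 1 *_) (^-distribˡ-+-* 2 (ℓ * d) (triangular a)) ⟨
    m ^ a * 1 * 2 ^ (ℓ * d + triangular a) ∎
    where
    open ≤-Reasoning
    C = length (filter (λ h → 2 ^ a ∸ 2 <? Z us h y) (allLinMaps d ℓ))
    rearrange₁ : ∀ c q p r → c * q * (p * r) ≡ c * p * (q * r)
    rearrange₁ = solve-∀
    rearrange₂ : ∀ c p f t → c * p * (f * t) ≡ c * f * p * t
    rearrange₂ = solve-∀
    rearrange₃ : ∀ x e t → x * e * t ≡ x * 1 * (e * t)
    rearrange₃ = solve-∀

open import Defs
open DyadicRationals
open PartialProducts
open import Data.Nat using (ℕ; _^_; _∸_; _*_; _≥_; _<?_)
open import Data.Rational using (ℚ; _≤_; _<_; _+_; 0ℚ; ½) renaming (_*_ to _*ℚ_)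
import Data.Rational.Properties as ℚ
open import Data.List using (length; filter)
open import Data.Vec using (Vec; lookup)
open import Data.Fin using (Fin)
open import Data.Product using (∃; _,_)
open import Function.Definitions using (Injective)
open import Relation.Binary.PropositionalEquality using (_≡_; subst)
open import Relation.Nullary using (¬_)

p≤p+ε : ∀ p {ε} → 0ℚ < ε → p ≤ p + ε
p≤p+ε p ε>0 = subst (_≤ p + _) (ℚ.+-identityʳ p) (ℚ.+-monoʳ-≤ p (ℚ.<⇒≤ ε>0))

corollaryB2 : (d ℓ m : ℕ) (us : Vec (𝔽₂^ d) m) →
              Injective _≡_ _≡_ (lookup us) →
              (∀ (i : Fin m) → ¬ (lookup us i ≡ zeroVec d)) →
              (y : 𝔽₂^ ℓ) (a : ℕ) → a ≥ 1 →
              (ε : ℚ) → 0ℚ < ε →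
              ∃ λ (N : ℕ) →
                PrZgt us y (2 ^ a ∸ 2) *ℚ P N
                  ≤ ((lam m ℓ ^ℚ a) *ℚ (½ ^ℚ (a * a))) + ε
corollaryB2 d ℓ m us us-injective us-nonzero y a a≥1 ε ε>0 =
  a , ℚ.≤-trans Pr*P≤bound (p≤p+ε ((lam m ℓ ^ℚ a) *ℚ (½ ^ℚ (a * a))) ε>0)
  where
  largeFibres = length (filter (λ h → 2 ^ a ∸ 2 <? Z us h y) (allLinMaps d ℓ))
  Pr*P≤bound : PrZgt us y (2 ^ a ∸ 2) *ℚ P a ≤ (lam m ℓ ^ℚ a) *ℚ (½ ^ℚ (a * a))
  Pr*P≤bound = ≤-dyadic (*-dyadic (/2^-dyadic largeFibres (ℓ * d)) (P-dyadic a))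
                        (*-dyadic (^ℚ-dyadic a (/2^-dyadic m ℓ)) (½^-dyadic (a * a)))
                        (largeFibres-cross-multiplied us us-injective us-nonzero y a a≥1)
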